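{- Let $Q$ be an ice quiver whose mutable subquiver is a mutation-cyclic quiver on three vertices. Suppose that for every mutable vertex $v$, the ice quiver $\mu_v(Q)$ satisfies (all vertices below being mutable): (a) every mutable vertex of $\mu_v(Q)$ is red or green; (b) if $b^{[v]}_{vj}c^{[v]}_j\ge0$ for some $j\ne v$, then $\mathrm{sgn}(c^{[v]}_j)=\mathrm{sgn}(c^{[v]}_v)$ or $\mathrm{sgn}(c^{[v]}_j)c^{[v]}_j\ge\mathrm{sgn}(c^{[v]}_v)c^{[v]}_v$; (c) if $b^{[v]}_{vj}c^{[v]}_j\le0$ for some $j\ne v$, then $\mathrm{sgn}(c^{[v]}_j)=-\mathrm{sgn}(c^{[v]}_v)$; (d) if $b^{[v]}_{ij}c^{[v]}_j\ge0$ for distinct $i,j$ both different from $v$, then $\mathrm{sgn}(c^{[v]}_i)=\mathrm{sgn}(c^{[v]}_j)$. Then $Q$ is strictly sign-coherent. In particular, the framing and the coframing of any mutation-cyclic quiver on three vertices are strictly sign-coherent.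
   Context: Quivers have no loops or 2-cycles. An ice quiver has mutable vertices $1,\dots,n$ and frozen vertices $n+1,\dots,n+m$; mutation (only at mutable vertices) at $k$: add an arrow $a\to b$ for each path $a\to k\to b$, reverse arrows at $k$, delete 2-cycles. Its extended exchange matrix is $[B\mid C]$ with $b_{ij}=$ (number of arrows $i\to j$ minus number of arrows $j\to i$) for mutable $i,j$, and $C$ given by the same rule for mutable $i$ and frozen $j$; superscript $[v]$ denotes the matrices of $\mu_v(Q)$, and $c^{[v]}_i$ is the $i$-th row of $C^{[v]}$. A mutable vertex $i$ is green iff $c_i$ is nonzero with entries $\ge0$ ($\mathrm{sgn}(c_i)=1$), red iff nonzero with entries $\le0$ ($\mathrm{sgn}(c_i)=-1$). Vector inequalities are componentwise. An ice quiver is strictly sign-coherent if every ice quiver obtained from it by a sequence of mutations has every mutable vertex red or green. A quiver is mutation-cyclic if no quiver obtained from it by mutations is acyclic (has no directed cycle). The framing of a quiver $Q$ adds for each vertex $i$ a frozen vertex $i'$ with one arrow $i\to i'$; the coframing adds a frozen $i'$ with one arrow $i'\to i$. -}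

module Defs where

open import Data.Nat as ℕ using (ℕ; zero; suc; _∸_; _<_)
open import Data.Integer as ℤ using (ℤ; +_; _-_; _*_; _≤_; -1ℤ; 0ℤ; 1ℤ)
import Data.Integer.Properties as ℤP
open import Data.Fin using (Fin)
import Data.Fin.Properties as FinP
open import Data.Sum using (_⊎_; inj₁; inj₂)
import Data.Sum.Properties as SumP
open import Data.Product using (_×_; ∃-syntax)
open import Data.List using (List; []; _∷_)
open import Relation.Nullary using (¬_; Dec; yes; no)
open import Relation.Binary.Definitions using (DecidableEquality)
open import Relation.Binary.PropositionalEquality using (_≡_; _≢_)

-- Quivers on a vertex type V, given by arrow multiplicities.
-- Q a b = number of arrows a → b.

Quiver : Set → Set
Quiver V = V → V → ℕ

IsQuiver : {V : Set} → Quiver V → Set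
IsQuiver {V} Q = (∀ a → Q a a ≡ 0) × (∀ a b → Q a b ≡ 0 ⊎ Q b a ≡ 0)

-- Quiver mutation at k: for a,b ≠ k add Q a k * Q k b arrows a → b
-- (one per path a → k → b), reverse the arrows at k, then cancel 2-cycles.
mutate : {V : Set} → DecidableEquality V → V → Quiver V → Quiver V
mutate _≟_ k Q a b with a ≟ k | b ≟ k
... | yes _ | _     = Q b a
... | no _  | yes _ = Q b a
... | no _  | no _  =
  (Q a b ℕ.+ Q a k ℕ.* Q k b) ∸ (Q b a ℕ.+ Q b k ℕ.* Q k a)

mutateSeq : {V : Set} → DecidableEquality V → List V → Quiver V → Quiver V
mutateSeq _≟_ []       Q = Q
mutateSeq _≟_ (k ∷ ks) Q = mutateSeq _≟_ ks (mutate _≟_ k Q)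

data Path {V : Set} (Q : Quiver V) : V → V → Set where
  edge : ∀ {a b} → 0 < Q a b → Path Q a b
  step : ∀ {a b c} → 0 < Q a b → Path Q b c → Path Q a c

Acyclic : {V : Set} → Quiver V → Set
Acyclic {V} Q = ∀ (a : V) → ¬ Path Q a a

MutationCyclic : {n : ℕ} → Quiver (Fin n) → Set
MutationCyclic {n} Q = ∀ (ks : List (Fin n)) → ¬ Acyclic (mutateSeq FinP._≟_ ks Q)

-- Ice quivers: mutable vertices Fin n (inj₁), frozen vertices Fin m (inj₂).

IceQuiver : ℕ → ℕ → Set
IceQuiver n m = Quiver (Fin n ⊎ Fin m)

_≟V_ : {n m : ℕ} → DecidableEquality (Fin n ⊎ Fin m)
_≟V_ = SumP.≡-dec FinP._≟_ FinP._≟_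

μ : {n m : ℕ} → Fin n → IceQuiver n m → IceQuiver n m
μ k Q = mutate _≟V_ (inj₁ k) Q

μSeq : {n m : ℕ} → List (Fin n) → IceQuiver n m → IceQuiver n m
μSeq []       Q = Q
μSeq (k ∷ ks) Q = μSeq ks (μ k Q)

mutableSubquiver : {n m : ℕ} → IceQuiver n m → Quiver (Fin n)
mutableSubquiver Q i j = Q (inj₁ i) (inj₁ j)

B : {n m : ℕ} → IceQuiver n m → Fin n → Fin n → ℤ
B Q i j = + Q (inj₁ i) (inj₁ j) - + Q (inj₁ j) (inj₁ i)

c : {n m : ℕ} → IceQuiver n m → Fin n → Fin m → ℤ
c Q i f = + Q (inj₁ i) (inj₂ f) - + Q (inj₂ f) (inj₁ i)

Vecℤ : ℕ → Set
Vecℤ m = Fin m → ℤ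

_≤v_ : {m : ℕ} → Vecℤ m → Vecℤ m → Set
u ≤v w = ∀ f → u f ≤ w f

0v : {m : ℕ} → Vecℤ m
0v _ = 0ℤ

_·v_ : {m : ℕ} → ℤ → Vecℤ m → Vecℤ m
(a ·v u) f = a * u f

NonZeroV : {m : ℕ} → Vecℤ m → Set
NonZeroV u = ¬ (∀ f → u f ≡ 0ℤ)

IsGreenV : {m : ℕ} → Vecℤ m → Set
IsGreenV u = NonZeroV u × (0v ≤v u)

IsRedV : {m : ℕ} → Vecℤ m → Set
IsRedV u = NonZeroV u × (u ≤v 0v)

green? : {m : ℕ} (u : Vecℤ m) → Dec (IsGreenV u)
green? u with FinP.all? (λ f → u f ℤ.≟ 0ℤ) | FinP.all? (λ f → 0ℤ ℤ.≤? u f)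
... | yes z | _     = no (λ g → Data.Product.proj₁ g z)
  where import Data.Product
... | no nz | yes p = yes (nz Data.Product., p)
  where import Data.Product
... | no nz | no np = no (λ g → np (Data.Product.proj₂ g))
  where import Data.Product

red? : {m : ℕ} (u : Vecℤ m) → Dec (IsRedV u)
red? u with FinP.all? (λ f → u f ℤ.≟ 0ℤ) | FinP.all? (λ f → u f ℤ.≤? 0ℤ)
... | yes z | _     = no (λ g → Data.Product.proj₁ g z)
  where import Data.Product
... | no nz | yes p = yes (nz Data.Product., p)
  where import Data.Product
... | no nz | no np = no (λ g → np (Data.Product.proj₂ g))
  where import Data.Product

-- sgn of a vector: 1 if green (nonzero, ≥ 0), -1 if red (nonzero, ≤ 0),
-- 0 otherwise (only used where the vector is red or green)
sgnV : {m : ℕ} → Vecℤ m → ℤ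
sgnV u with green? u | red? u
... | yes _ | _     = 1ℤ
... | no _  | yes _ = -1ℤ
... | no _  | no _  = 0ℤ

Green Red : {n m : ℕ} → IceQuiver n m → Fin n → Set
Green Q i = IsGreenV (c Q i)
Red   Q i = IsRedV (c Q i)

AllRedOrGreen : {n m : ℕ} → IceQuiver n m → Set
AllRedOrGreen {n} Q = ∀ (i : Fin n) → Red Q i ⊎ Green Q i

StrictlySignCoherent : {n m : ℕ} → IceQuiver n m → Set
StrictlySignCoherent {n} Q = ∀ (ks : List (Fin n)) → AllRedOrGreen (μSeq ks Q)

ConditionsAt : {n m : ℕ} → IceQuiver n m → Fin n → Set
ConditionsAt {n} {m} Q v =
  let Q′ = μ v Q
      b  = B Q′
      cc = c Q′
  in
  AllRedOrGreen Q′
  × (∀ (j : Fin n) → j ≢ v → 0v ≤v (b v j ·v cc j) →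
       (sgnV (cc j) ≡ sgnV (cc v))
       ⊎ ((sgnV (cc v) ·v cc v) ≤v (sgnV (cc j) ·v cc j)))
  × (∀ (j : Fin n) → j ≢ v → (b v j ·v cc j) ≤v 0v →
       sgnV (cc j) ≡ ℤ.- sgnV (cc v))
  × (∀ (i j : Fin n) → i ≢ j → i ≢ v → j ≢ v → 0v ≤v (b i j ·v cc j) →
       sgnV (cc i) ≡ sgnV (cc j))

-- Framing and coframing of a quiver on Fin n (frozen copy i' = inj₂ i)

framing : {n : ℕ} → Quiver (Fin n) → IceQuiver n n
framing Q (inj₁ i) (inj₁ j) = Q i j
framing Q (inj₁ i) (inj₂ j) with i FinP.≟ j
... | yes _ = 1
... | no _  = 0
framing Q (inj₂ _) _        = 0

coframing : {n : ℕ} → Quiver (Fin n) → IceQuiver n n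
coframing Q (inj₁ i) (inj₁ j) = Q i j
coframing Q (inj₂ i) (inj₁ j) with i FinP.≟ j
... | yes _ = 1
... | no _  = 0
coframing Q (inj₁ _) (inj₂ _) = 0
coframing Q (inj₂ _) (inj₂ _) = 0

-- A mutation-cyclic quiver on three vertices is an oriented triangle with at least two arrows
-- on every side: any other quiver on three vertices has a source or a sink, hence is acyclic,
-- and a side carrying a single arrow produces a source after mutating at one of its ends.
-- Mutation at any vertex reverses the orientation of the triangle.
--
-- Write v → J → I → v for the triangle of μ_v Q. The invariant carried along mutation
-- sequences is: either v is green, I is red and c_v ≤ −c_I, or v is red, J is green and
-- −c_v ≤ c_J; the third vertex is red or green. Conditions (a)–(c) give it right after the
-- first mutation, and for a framed (coframed) quiver it holds because every vertex starts
-- green (red). Since each side carries at least two arrows, mutating at J or at I moves the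
-- invariant to the new root, while mutating at v again undoes the last mutation.

module Submission where

open import Defs
open import Data.Nat as ℕ using (ℕ; zero; suc; _+_; _*_; _∸_; _<_; _≤_; z≤n; s≤s)
import Data.Nat.Properties as ℕP
open import Data.Integer as ℤ using (+≤+; 0ℤ; 1ℤ; -1ℤ)
import Data.Integer.Properties as ℤP
open import Data.Fin using (Fin)
open import Data.Fin.Patterns using (0F; 1F; 2F)
import Data.Fin.Properties as FinP
open import Data.Sum using (_⊎_; inj₁; inj₂; [_,_]′)
import Data.Sum.Properties as SumP
open import Data.Product using (_×_; _,_; proj₁; proj₂; ∃-syntax)
open import Data.List using ([]; _∷_)
open import Function using (id; _∘_)
open import Relation.Nullary using (¬_; Dec; yes; no; contradiction)
open import Relation.Binary.Definitions using (DecidableEquality; Transitive; Irreflexive)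
open import Relation.Binary.PropositionalEquality hiding ([_]; J)

-- Quiver mutation

_≈_ : {V : Set} → Quiver V → Quiver V → Set
Q ≈ Q′ = ∀ a b → Q a b ≡ Q′ a b

≈-sym : {V : Set} {Q Q′ : Quiver V} → Q ≈ Q′ → Q′ ≈ Q
≈-sym e a b = sym (e a b)

≈-trans : {V : Set} {Q Q′ Q″ : Quiver V} → Q ≈ Q′ → Q′ ≈ Q″ → Q ≈ Q″
≈-trans e e′ a b = trans (e a b) (e′ a b)

m∸n≡0⊎n∸m≡0 : ∀ x y → x ∸ y ≡ 0 ⊎ y ∸ x ≡ 0
m∸n≡0⊎n∸m≡0 x y with ℕP.≤-total x y
... | inj₁ x≤y = inj₁ (ℕP.m≤n⇒m∸n≡0 x≤y)
... | inj₂ y≤x = inj₂ (ℕP.m≤n⇒m∸n≡0 y≤x)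

-- both sides are x ⊔ y
m∸n+n≡n∸m+m : ∀ x y → x ∸ y + y ≡ y ∸ x + x
m∸n+n≡n∸m+m x y with ℕP.≤-total x y
... | inj₁ x≤y rewrite ℕP.m≤n⇒m∸n≡0 x≤y = sym (ℕP.m∸n+n≡m x≤y)
... | inj₂ y≤x rewrite ℕP.m≤n⇒m∸n≡0 y≤x = ℕP.m∸n+n≡m y≤x

-- the entry a → b of μ_k (μ_k Q) for a, b ≠ k: A and B count the arrows a → b and b → a,
-- P and N the paths a → k → b and b → k → a
mutate-twice-arith : ∀ A B P N → A ≡ 0 ⊎ B ≡ 0 →
  ((A + P) ∸ (B + N) + N) ∸ ((B + N) ∸ (A + P) + P) ≡ A
mutate-twice-arith .0 B P N (inj₁ refl) = begin
  (P ∸ Y + N) ∸ (Y ∸ P + P)  ≡⟨ cong ((P ∸ Y + N) ∸_) (sym (m∸n+n≡n∸m+m P Y)) ⟩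
  (P ∸ Y + N) ∸ (P ∸ Y + Y)  ≡⟨ ℕP.[m+n]∸[m+o]≡n∸o (P ∸ Y) N Y ⟩
  N ∸ Y                      ≡⟨ ℕP.m≤n⇒m∸n≡0 (ℕP.m≤n+m N B) ⟩
  0                          ∎
  where open ≡-Reasoning
        Y = B + N
mutate-twice-arith A .0 P N (inj₂ refl) = begin
  (X ∸ N + N) ∸ (N ∸ X + P)    ≡⟨ cong (_∸ (N ∸ X + P)) (m∸n+n≡n∸m+m X N) ⟩
  (N ∸ X + (A + P)) ∸ (N ∸ X + P) ≡⟨ cong (_∸ (N ∸ X + P)) (ℕP.+-comm (N ∸ X) (A + P)) ⟩
  (A + P + (N ∸ X)) ∸ (N ∸ X + P) ≡⟨ cong (_∸ (N ∸ X + P)) (ℕP.+-assoc A P (N ∸ X)) ⟩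
  (A + (P + (N ∸ X))) ∸ (N ∸ X + P) ≡⟨ cong (λ t → (A + t) ∸ (N ∸ X + P)) (ℕP.+-comm P (N ∸ X)) ⟩
  (A + (N ∸ X + P)) ∸ (N ∸ X + P) ≡⟨ ℕP.m+n∸n≡m A (N ∸ X + P) ⟩
  A                             ∎
  where open ≡-Reasoning
        X = A + P

module Mutation {V : Set} (_≟_ : DecidableEquality V) where

  mutate-out : ∀ k (Q : Quiver V) b → mutate _≟_ k Q k b ≡ Q b k
  mutate-out k Q b with k ≟ k
  ... | yes _   = refl
  ... | no k≢k = contradiction refl k≢k

  mutate-in : ∀ k (Q : Quiver V) {a} → a ≢ k → mutate _≟_ k Q a k ≡ Q k a
  mutate-in k Q {a} a≢k with a ≟ k | k ≟ k
  ... | yes a≡k | _      = contradiction a≡k a≢k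
  ... | no _    | yes _  = refl
  ... | no _    | no k≢k = contradiction refl k≢k

  mutate-away : ∀ k (Q : Quiver V) {a b} → a ≢ k → b ≢ k →
    mutate _≟_ k Q a b ≡ (Q a b + Q a k * Q k b) ∸ (Q b a + Q b k * Q k a)
  mutate-away k Q {a} {b} a≢k b≢k with a ≟ k | b ≟ k
  ... | yes a≡k | _       = contradiction a≡k a≢k
  ... | no _    | yes b≡k = contradiction b≡k b≢k
  ... | no _    | no _    = refl

  mutate-cong : ∀ k {Q Q′ : Quiver V} → Q ≈ Q′ → mutate _≟_ k Q ≈ mutate _≟_ k Q′
  mutate-cong k e a b with a ≟ k | b ≟ k
  ... | yes _ | _     = e b a
  ... | no _  | yes _ = e b a
  ... | no _  | no _  rewrite e a b | e a k | e k b | e b a | e b k | e k a = refl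

  mutateSeq-cong : ∀ ks {Q Q′ : Quiver V} → Q ≈ Q′ → mutateSeq _≟_ ks Q ≈ mutateSeq _≟_ ks Q′
  mutateSeq-cong []       e = e
  mutateSeq-cong (k ∷ ks) e = mutateSeq-cong ks (mutate-cong k e)

  mutate-isQuiver : ∀ k {Q : Quiver V} → IsQuiver Q → IsQuiver (mutate _≟_ k Q)
  mutate-isQuiver k {Q} (loopless , no2cycle) =
    (λ a → loopless′ a (a ≟ k)) , λ a b → no2cycle′ (a ≟ k) (b ≟ k)
    where
    loopless′ : ∀ a → Dec (a ≡ k) → mutate _≟_ k Q a a ≡ 0
    loopless′ a (yes refl) = trans (mutate-out k Q k) (loopless k)
    loopless′ a (no a≢k)   = trans (mutate-away k Q a≢k a≢k) (ℕP.n∸n≡0 (Q a a + Q a k * Q k a))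
    no2cycle′ : ∀ {a b} → Dec (a ≡ k) → Dec (b ≡ k) →
      mutate _≟_ k Q a b ≡ 0 ⊎ mutate _≟_ k Q b a ≡ 0
    no2cycle′ (yes refl) (yes refl) = inj₁ (loopless′ k (yes refl))
    no2cycle′ {b = b} (yes refl) (no b≢k) rewrite mutate-out k Q b | mutate-in k Q b≢k = no2cycle b k
    no2cycle′ {a = a} (no a≢k) (yes refl) rewrite mutate-out k Q a | mutate-in k Q a≢k = no2cycle k a
    no2cycle′ {a} {b} (no a≢k) (no b≢k) rewrite mutate-away k Q a≢k b≢k | mutate-away k Q b≢k a≢k =
      m∸n≡0⊎n∸m≡0 (Q a b + Q a k * Q k b) (Q b a + Q b k * Q k a)

  mutate-involutive : ∀ k {Q : Quiver V} → IsQuiver Q → mutate _≟_ k (mutate _≟_ k Q) ≈ Q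
  mutate-involutive k {Q} (_ , no2cycle) a b = twice (a ≟ k) (b ≟ k)
    where
    twice : ∀ {a b} → Dec (a ≡ k) → Dec (b ≡ k) → mutate _≟_ k (mutate _≟_ k Q) a b ≡ Q a b
    twice (yes refl) (yes refl) = trans (mutate-out k (mutate _≟_ k Q) k) (mutate-out k Q k)
    twice {b = b} (yes refl) (no b≢k) = trans (mutate-out k (mutate _≟_ k Q) b) (mutate-in k Q b≢k)
    twice {a = a} (no a≢k) (yes refl) = trans (mutate-in k (mutate _≟_ k Q) a≢k) (mutate-out k Q a)
    twice {a} {b} (no a≢k) (no b≢k)
      rewrite mutate-away k (mutate _≟_ k Q) a≢k b≢k | mutate-away k Q a≢k b≢k | mutate-away k Q b≢k a≢k
            | mutate-in k Q a≢k | mutate-in k Q b≢k | mutate-out k Q a | mutate-out k Q b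
            | ℕP.*-comm (Q k a) (Q b k) | ℕP.*-comm (Q k b) (Q a k)
      = mutate-twice-arith (Q a b) (Q b a) (Q a k * Q k b) (Q b k * Q k a) (no2cycle a b)

  path-cong : ∀ {Q Q′ : Quiver V} → Q ≈ Q′ → ∀ {a b} → Path Q a b → Path Q′ a b
  path-cong e {a} {b} (edge p)          = edge (subst (0 <_) (e a b) p)
  path-cong e {a}     (step {b = b} p w) = step (subst (0 <_) (e a b) p) (path-cong e w)

  acyclic-cong : ∀ {Q Q′ : Quiver V} → Q ≈ Q′ → Acyclic Q → Acyclic Q′
  acyclic-cong e acyclic a cycle = acyclic a (path-cong (≈-sym e) cycle)

  acyclic-by-rank : ∀ {A : Set} {_≺_ : A → A → Set} → Transitive _≺_ → Irreflexive _≡_ _≺_ →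
    ∀ {Q : Quiver V} (rank : V → A) → (∀ {a b} → 0 < Q a b → rank a ≺ rank b) → Acyclic Q
  acyclic-by-rank {_≺_ = _≺_} ≺-trans ≺-irrefl {Q} rank mono a cycle = ≺-irrefl refl (climb cycle)
    where
    climb : ∀ {a b} → Path Q a b → rank a ≺ rank b
    climb (edge p)   = mono p
    climb (step p w) = ≺-trans (mono p) (climb w)

module MutationFin {n : ℕ} = Mutation (FinP._≟_ {n})
module MutationIce {n m : ℕ} = Mutation (_≟V_ {n} {m})

open MutationFin

-- Quivers on three vertices

data Orientation : Set where
  ↻ ↺ : Orientation

opposite : Orientation → Orientation
opposite ↻ = ↺
opposite ↺ = ↻

next : Orientation → Fin 3 → Fin 3
next ↻ 0F = 1F
next ↻ 1F = 2F
next ↻ 2F = 0F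
next ↺ 0F = 2F
next ↺ 1F = 0F
next ↺ 2F = 1F

prev : Orientation → Fin 3 → Fin 3
prev d = next (opposite d)

next-next : ∀ d x → next d (next d x) ≡ prev d x
next-next ↻ 0F = refl
next-next ↻ 1F = refl
next-next ↻ 2F = refl
next-next ↺ 0F = refl
next-next ↺ 1F = refl
next-next ↺ 2F = refl

next-prev : ∀ d x → next d (prev d x) ≡ x
next-prev ↻ 0F = refl
next-prev ↻ 1F = refl
next-prev ↻ 2F = refl
next-prev ↺ 0F = refl
next-prev ↺ 1F = refl
next-prev ↺ 2F = refl

prev-next : ∀ d x → prev d (next d x) ≡ x
prev-next ↻ = next-prev ↺
prev-next ↺ = next-prev ↻

prev-prev : ∀ d x → prev d (prev d x) ≡ next d x
prev-prev ↻ = next-next ↺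
prev-prev ↺ = next-next ↻

cover : ∀ d x a → a ≡ x ⊎ a ≡ next d x ⊎ a ≡ prev d x
cover ↻ 0F 0F = inj₁ refl
cover ↻ 0F 1F = inj₂ (inj₁ refl)
cover ↻ 0F 2F = inj₂ (inj₂ refl)
cover ↻ 1F 0F = inj₂ (inj₂ refl)
cover ↻ 1F 1F = inj₁ refl
cover ↻ 1F 2F = inj₂ (inj₁ refl)
cover ↻ 2F 0F = inj₂ (inj₁ refl)
cover ↻ 2F 1F = inj₂ (inj₂ refl)
cover ↻ 2F 2F = inj₁ refl
cover ↺ 0F 0F = inj₁ refl
cover ↺ 0F 1F = inj₂ (inj₂ refl)
cover ↺ 0F 2F = inj₂ (inj₁ refl)
cover ↺ 1F 0F = inj₂ (inj₁ refl)
cover ↺ 1F 1F = inj₁ refl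
cover ↺ 1F 2F = inj₂ (inj₂ refl)
cover ↺ 2F 0F = inj₂ (inj₂ refl)
cover ↺ 2F 1F = inj₂ (inj₁ refl)
cover ↺ 2F 2F = inj₁ refl

Distinct : Fin 3 → Fin 3 → Fin 3 → Set
Distinct x y z = x ≢ y × y ≢ z × z ≢ x

orbit-distinct : ∀ d x → Distinct x (next d x) (prev d x)
orbit-distinct ↻ 0F = (λ ()) , (λ ()) , (λ ())
orbit-distinct ↻ 1F = (λ ()) , (λ ()) , (λ ())
orbit-distinct ↻ 2F = (λ ()) , (λ ()) , (λ ())
orbit-distinct ↺ 0F = (λ ()) , (λ ()) , (λ ())
orbit-distinct ↺ 1F = (λ ()) , (λ ()) , (λ ())
orbit-distinct ↺ 2F = (λ ()) , (λ ()) , (λ ())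

≢⇒next : ∀ {x y} → x ≢ y → ∃[ d ] y ≡ next d x
≢⇒next {x} {y} x≢y with cover ↻ x y
... | inj₁ y≡x          = contradiction (sym y≡x) x≢y
... | inj₂ (inj₁ y≡next) = ↻ , y≡next
... | inj₂ (inj₂ y≡prev) = ↺ , y≡prev

distinct-cover : ∀ {x y z} → Distinct x y z → ∀ a → a ≡ x ⊎ a ≡ y ⊎ a ≡ z
distinct-cover {x} {y} {z} (x≢y , y≢z , z≢x) a with ≢⇒next x≢y
... | d , refl with cover d x z | cover d x a
...   | inj₁ z≡x          | _ = contradiction z≡x z≢x
...   | inj₂ (inj₁ z≡y)   | _ = contradiction (sym z≡y) y≢z
...   | inj₂ (inj₂ refl)   | a≡ = a≡

around : ∀ {p} {P : Fin 3 → Set p} {x y z} → Distinct x y z → P x → P y → P z → ∀ a → P a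
around {P = P} {x} {y} {z} distinct px py pz a with distinct-cover distinct a
... | inj₁ refl          = px
... | inj₂ (inj₁ refl)   = py
... | inj₂ (inj₂ refl)   = pz

clockwise-distance : Fin 3 → Fin 3 → ℕ
clockwise-distance 0F 0F = 0
clockwise-distance 0F 1F = 1
clockwise-distance 0F 2F = 2
clockwise-distance 1F 0F = 2
clockwise-distance 1F 1F = 0
clockwise-distance 1F 2F = 1
clockwise-distance 2F 0F = 1
clockwise-distance 2F 1F = 2
clockwise-distance 2F 2F = 0

offset : Orientation → Fin 3 → Fin 3 → ℕ
offset ↻ s x = clockwise-distance s x
offset ↺ s x = clockwise-distance x s

offset-self : ∀ d s → offset d s s ≡ 0
offset-self ↻ 0F = refl
offset-self ↻ 1F = refl
offset-self ↻ 2F = refl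
offset-self ↺ 0F = refl
offset-self ↺ 1F = refl
offset-self ↺ 2F = refl

offset-next : ∀ d s → offset d s (next d s) ≡ 1
offset-next ↻ 0F = refl
offset-next ↻ 1F = refl
offset-next ↻ 2F = refl
offset-next ↺ 0F = refl
offset-next ↺ 1F = refl
offset-next ↺ 2F = refl

offset-prev : ∀ d s → offset d s (prev d s) ≡ 2
offset-prev ↻ 0F = refl
offset-prev ↻ 1F = refl
offset-prev ↻ 2F = refl
offset-prev ↺ 0F = refl
offset-prev ↺ 1F = refl
offset-prev ↺ 2F = refl

zero-not-positive : ∀ {n} → n ≡ 0 → ¬ 0 < n
zero-not-positive refl ()

module _ {R : Quiver (Fin 3)} (loopless : ∀ a → R a a ≡ 0) where

  -- rank s first, then the other two vertices in the direction of the arrow between them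
  source-ranked : ∀ {d s} → (∀ a → R a s ≡ 0) → R (prev d s) (next d s) ≡ 0 →
    ∀ {a b} → 0 < R a b → offset d s a < offset d s b
  source-ranked {d} {s} noIn back {a} {b} a→b with cover d s a | cover d s b
  ... | inj₁ refl        | inj₁ refl        = contradiction a→b (zero-not-positive (loopless s))
  ... | inj₁ refl        | inj₂ (inj₁ refl) rewrite offset-self d s | offset-next d s = s≤s z≤n
  ... | inj₁ refl        | inj₂ (inj₂ refl) rewrite offset-self d s | offset-prev d s = s≤s z≤n
  ... | inj₂ (inj₁ refl) | inj₁ refl        = contradiction a→b (zero-not-positive (noIn a))
  ... | inj₂ (inj₁ refl) | inj₂ (inj₁ refl) = contradiction a→b (zero-not-positive (loopless a))
  ... | inj₂ (inj₁ refl) | inj₂ (inj₂ refl) rewrite offset-next d s | offset-prev d s = s≤s (s≤s z≤n)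
  ... | inj₂ (inj₂ refl) | inj₁ refl        = contradiction a→b (zero-not-positive (noIn a))
  ... | inj₂ (inj₂ refl) | inj₂ (inj₁ refl) = contradiction a→b (zero-not-positive back)
  ... | inj₂ (inj₂ refl) | inj₂ (inj₂ refl) = contradiction a→b (zero-not-positive (loopless a))

  forward-orientation : (∀ a b → R a b ≡ 0 ⊎ R b a ≡ 0) → ∀ s → ∃[ d ] R (prev d s) (next d s) ≡ 0
  forward-orientation no2cycle s with no2cycle (next ↻ s) (prev ↻ s)
  ... | inj₁ back = ↺ , back
  ... | inj₂ back = ↻ , back

source⇒acyclic : ∀ {R : Quiver (Fin 3)} {s} → IsQuiver R → (∀ a → R a s ≡ 0) → Acyclic R
source⇒acyclic {R} {s} (loopless , no2cycle) noIn with forward-orientation loopless no2cycle s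
... | d , back = acyclic-by-rank ℕP.<-trans ℕP.<-irrefl (offset d s)
                   (source-ranked {R = R} loopless {d} noIn back)

sink⇒acyclic : ∀ {R : Quiver (Fin 3)} {s} → IsQuiver R → (∀ a → R s a ≡ 0) → Acyclic R
sink⇒acyclic {R} {s} (loopless , no2cycle) noOut with forward-orientation loopless (λ a b → no2cycle b a) s
... | d , back = acyclic-by-rank (λ p q → ℕP.<-trans q p) (λ eq → ℕP.<-irrefl (sym eq)) (offset d s)
                   (source-ranked {R = λ a b → R b a} loopless {d} noOut back)

Oriented : Quiver (Fin 3) → Orientation → Set
Oriented R d = ∀ x → 0 < R x (next d x)

CyclicTriangle : Quiver (Fin 3) → Orientation → Set
CyclicTriangle R d = ∀ x → 2 ≤ R x (next d x) × R (next d x) x ≡ 0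

module _ {R : Quiver (Fin 3)} (isQ : IsQuiver R) where
  private
    loopless = proj₁ isQ
    no2cycle = proj₂ isQ

  reverse-zero : ∀ {a b} → 0 < R a b → R b a ≡ 0
  reverse-zero {a} {b} a→b with no2cycle a b
  ... | inj₁ a↛b = contradiction a→b (zero-not-positive a↛b)
  ... | inj₂ b↛a = b↛a

  missing-arrow : ∀ d → ¬ Oriented R d → ∃[ x ] R x (next d x) ≡ 0
  missing-arrow d ¬oriented with FinP.¬∀⟶∃¬ 3 _ (λ x → 0 ℕ.<? R x (next d x)) ¬oriented
  ... | x , ¬positive = x , ℕP.n≤0⇒n≡0 (ℕP.≮⇒≥ ¬positive)

  -- missing arrows x ↛ next x and y ↛ prev y leave a source or a sink
  unoriented⇒acyclic : ∀ {x y} → R x (next ↻ x) ≡ 0 → R y (prev ↻ y) ≡ 0 → Acyclic R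
  unoriented⇒acyclic {x} {y} x↛ y↛ with cover ↻ x y
  ... | inj₁ refl = sink⇒acyclic isQ (around (orbit-distinct ↻ x) (loopless x) x↛ y↛)
  ... | inj₂ (inj₁ refl) with no2cycle x (prev ↻ x)
  ...   | inj₁ x↛prev = sink⇒acyclic isQ (around (orbit-distinct ↻ x) (loopless x) x↛ x↛prev)
  ...   | inj₂ prev↛x = source⇒acyclic isQ
                          (around (orbit-distinct ↻ x) (loopless x)
                             (subst (λ t → R (next ↻ x) t ≡ 0) (prev-next ↻ x) y↛) prev↛x)
  unoriented⇒acyclic {x} {y} x↛ y↛ | inj₂ (inj₂ refl) = source⇒acyclic isQ
    (around (orbit-distinct ↻ x) x↛ (loopless (next ↻ x))
       (subst (λ t → R (prev ↻ x) t ≡ 0) (prev-prev ↻ x) y↛))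

  cyclic⇒oriented : ¬ Acyclic R → ∃[ d ] Oriented R d
  cyclic⇒oriented cyclic
    with FinP.all? (λ x → 0 ℕ.<? R x (next ↻ x)) | FinP.all? (λ x → 0 ℕ.<? R x (next ↺ x))
  ... | yes oriented | _            = ↻ , oriented
  ... | no _         | yes oriented = ↺ , oriented
  ... | no ¬↻        | no ¬↺        with missing-arrow ↻ ¬↻ | missing-arrow ↺ ¬↺
  ...   | _ , x↛ | _ , y↛ = contradiction (unoriented⇒acyclic x↛ y↛) cyclic

  -- On x → y → z → x with a single arrow x → y, either μ_x makes y a source or μ_y makes z one.
  single-arrow⇒acyclic-mutation : ∀ {x y z} → Distinct x y z →
    R x y ≡ 1 → R y x ≡ 0 → R z y ≡ 0 → R x z ≡ 0 →
    Acyclic (mutate FinP._≟_ x R) ⊎ Acyclic (mutate FinP._≟_ y R)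
  single-arrow⇒acyclic-mutation {x} {y} {z} distinct@(x≢y , y≢z , z≢x) x→y y↛x z↛y x↛z
    with ℕP.≤-total (R z x) (R y z)
  ... | inj₁ zx≤yz = inj₁ (source⇒acyclic (mutate-isQuiver x isQ)
                       (around distinct (trans (mutate-out x R y) y↛x) (proj₁ (mutate-isQuiver x isQ) y) z→x→y))
    where
    z→x→y : mutate FinP._≟_ x R z y ≡ 0
    z→x→y rewrite mutate-away x R z≢x (≢-sym x≢y) | z↛y | x→y | y↛x
                | ℕP.*-identityʳ (R z x) | ℕP.+-identityʳ (R y z) = ℕP.m≤n⇒m∸n≡0 zx≤yz
  ... | inj₂ yz≤zx = inj₂ (source⇒acyclic (mutate-isQuiver y isQ)
                       (around distinct x→y→z (trans (mutate-out y R z) z↛y) (proj₁ (mutate-isQuiver y isQ) z)))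
    where
    x→y→z : mutate FinP._≟_ y R x z ≡ 0
    x→y→z rewrite mutate-away y R x≢y (≢-sym y≢z) | x↛z | x→y | z↛y
                | ℕP.+-identityʳ (R y z) | ℕP.+-identityʳ (R z x) = ℕP.m≤n⇒m∸n≡0 yz≤zx

  nonacyclic⇒cyclicTriangle : ¬ Acyclic R → (∀ k → ¬ Acyclic (mutate FinP._≟_ k R)) →
    ∃[ d ] CyclicTriangle R d
  nonacyclic⇒cyclicTriangle cyclic mutations-cyclic with cyclic⇒oriented cyclic
  ... | d , oriented = d , λ x → heavy x , reverse-zero (oriented x)
    where
    heavy : ∀ x → 2 ≤ R x (next d x)
    heavy x with R x (next d x) in x→y | oriented x
    ... | suc (suc _) | _ = s≤s (s≤s z≤n)
    ... | suc zero    | _ with single-arrow⇒acyclic-mutation (orbit-distinct d x) x→y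
                               (reverse-zero (oriented x))
                               (subst (λ t → R t (next d x) ≡ 0) (next-next d x) (reverse-zero (oriented (next d x))))
                               (subst (λ t → R t (prev d x) ≡ 0) (next-prev d x) (reverse-zero (oriented (prev d x))))
    ...   | inj₁ acyclic = contradiction acyclic (mutations-cyclic x)
    ...   | inj₂ acyclic = contradiction acyclic (mutations-cyclic (next d x))

heavy⇒positive : ∀ {n} → 2 ≤ n → 0 < n
heavy⇒positive = ℕP.≤-trans (s≤s z≤n)

record Cycle (R : Quiver (Fin 3)) (v J I : Fin 3) : Set where
  field
    v⇉J : 2 ≤ R v J
    J⇉I : 2 ≤ R J I
    I⇉v : 2 ≤ R I v
    J↛v : R J v ≡ 0
    I↛J : R I J ≡ 0
    v↛I : R v I ≡ 0

  v≢J : v ≢ J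
  v≢J refl = zero-not-positive J↛v (heavy⇒positive v⇉J)

  J≢I : J ≢ I
  J≢I refl = zero-not-positive I↛J (heavy⇒positive J⇉I)

  I≢v : I ≢ v
  I≢v refl = zero-not-positive v↛I (heavy⇒positive I⇉v)

  distinct : Distinct v J I
  distinct = v≢J , J≢I , I≢v

cycle-at : ∀ {R d} → CyclicTriangle R d → ∀ v → Cycle R v (next d v) (prev d v)
cycle-at {R} {d} triangle v = record
  { v⇉J = proj₁ (triangle v)
  ; J⇉I = subst (λ t → 2 ≤ R (next d v) t) (next-next d v) (proj₁ (triangle (next d v)))
  ; I⇉v = subst (λ t → 2 ≤ R (prev d v) t) (next-prev d v) (proj₁ (triangle (prev d v)))
  ; J↛v = proj₂ (triangle v)
  ; I↛J = subst (λ t → R t (next d v) ≡ 0) (next-next d v) (proj₂ (triangle (next d v)))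
  ; v↛I = subst (λ t → R t (prev d v) ≡ 0) (next-prev d v) (proj₂ (triangle (prev d v)))
  }

cycle-through : ∀ {R d x y z} → CyclicTriangle R d → Distinct x y z → 0 < R x y → Cycle R x y z
cycle-through {R} {d} {x} {y} {z} triangle (x≢y , y≢z , z≢x) x→y with cover d x y | cover d x z
... | inj₁ refl        | _                = contradiction refl x≢y
... | inj₂ (inj₂ refl) | _                =
  contradiction x→y
    (zero-not-positive (subst (λ t → R t (prev d x) ≡ 0) (next-prev d x) (proj₂ (triangle (prev d x)))))
... | inj₂ (inj₁ refl) | inj₁ refl        = contradiction refl z≢x
... | inj₂ (inj₁ refl) | inj₂ (inj₁ refl) = contradiction refl y≢z
... | inj₂ (inj₁ refl) | inj₂ (inj₂ refl) = cycle-at triangle x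

mutationCyclic⇒cyclicTriangle : ∀ {R} → IsQuiver R → MutationCyclic R → ∃[ d ] CyclicTriangle R d
mutationCyclic⇒cyclicTriangle isQ cyclic = nonacyclic⇒cyclicTriangle isQ (cyclic []) (λ k → cyclic (k ∷ []))

-- Frozen arrows

out inn : {n m : ℕ} → IceQuiver n m → Fin n → Fin m → ℕ
out Q x f = Q (inj₁ x) (inj₂ f)
inn Q x f = Q (inj₂ f) (inj₁ x)

Nonzero : {m : ℕ} → (Fin m → ℕ) → Set
Nonzero g = ¬ (∀ f → g f ≡ 0)

-- green and red in terms of arrow counts (equivalent to Green and Red for quivers)
Outward Inward Coherent : {n m : ℕ} → IceQuiver n m → Fin n → Set
Outward Q x = (∀ f → inn Q x f ≡ 0) × Nonzero (out Q x)
Inward  Q x = (∀ f → out Q x f ≡ 0) × Nonzero (inn Q x)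
Coherent Q x = Outward Q x ⊎ Inward Q x

Outward≤Inward Inward≤Outward : {n m : ℕ} → IceQuiver n m → Fin n → Fin n → Set
Outward≤Inward Q x y = Outward Q x × Inward Q y × (∀ f → out Q x f ≤ inn Q y f)
Inward≤Outward Q x y = Inward Q x × Outward Q y × (∀ f → inn Q x f ≤ out Q y f)

nonzero-mono : ∀ {m} {g h : Fin m → ℕ} → (∀ f → g f ≤ h f) → Nonzero g → Nonzero h
nonzero-mono g≤h nonzero h≡0 = nonzero λ f → ℕP.n≤0⇒n≡0 (subst (_ ≤_) (h≡0 f) (g≤h f))

nonzero-cong : ∀ {m} {g h : Fin m → ℕ} → (∀ f → g f ≡ h f) → Nonzero g → Nonzero h
nonzero-cong g≡h = nonzero-mono (λ f → ℕP.≤-reflexive (g≡h f))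

module _ {n m : ℕ} where

  coherent-cong : ∀ {Q Q′ : IceQuiver n m} → Q ≈ Q′ → ∀ {x} → Coherent Q x → Coherent Q′ x
  coherent-cong e (inj₁ (noIn , nonzero))  =
    inj₁ ((λ f → trans (sym (e _ _)) (noIn f)) , nonzero-cong (λ f → e _ _) nonzero)
  coherent-cong e (inj₂ (noOut , nonzero)) =
    inj₂ ((λ f → trans (sym (e _ _)) (noOut f)) , nonzero-cong (λ f → e _ _) nonzero)

  private
    inj₁-≢ : ∀ {x k : Fin n} → x ≢ k → _≢_ {A = Fin n ⊎ Fin m} (inj₁ x) (inj₁ k)
    inj₁-≢ x≢k eq = x≢k (SumP.inj₁-injective eq)

  μ-out-self : ∀ k (Q : IceQuiver n m) f → out (μ k Q) k f ≡ inn Q k f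
  μ-out-self k Q f = MutationIce.mutate-out (inj₁ k) Q (inj₂ f)

  μ-inn-self : ∀ k (Q : IceQuiver n m) f → inn (μ k Q) k f ≡ out Q k f
  μ-inn-self k Q f = MutationIce.mutate-in (inj₁ k) Q (λ ())

  μ-out : ∀ {k x} (Q : IceQuiver n m) f → x ≢ k →
    out (μ k Q) x f ≡ (out Q x f + mutableSubquiver Q x k * out Q k f)
                    ∸ (inn Q x f + inn Q k f * mutableSubquiver Q k x)
  μ-out {k} Q f x≢k = MutationIce.mutate-away (inj₁ k) Q (inj₁-≢ x≢k) (λ ())

  μ-inn : ∀ {k x} (Q : IceQuiver n m) f → x ≢ k →
    inn (μ k Q) x f ≡ (inn Q x f + inn Q k f * mutableSubquiver Q k x)
                    ∸ (out Q x f + mutableSubquiver Q x k * out Q k f)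
  μ-inn {k} Q f x≢k = MutationIce.mutate-away (inj₁ k) Q (λ ()) (inj₁-≢ x≢k)

  μ-arrow-out : ∀ k (Q : IceQuiver n m) y → mutableSubquiver (μ k Q) k y ≡ mutableSubquiver Q y k
  μ-arrow-out k Q y = MutationIce.mutate-out (inj₁ k) Q (inj₁ y)

  μ-arrow-in : ∀ k (Q : IceQuiver n m) {y} → y ≢ k → mutableSubquiver (μ k Q) y k ≡ mutableSubquiver Q k y
  μ-arrow-in k Q y≢k = MutationIce.mutate-in (inj₁ k) Q (inj₁-≢ y≢k)

  mutableSubquiver-μ : ∀ k (Q : IceQuiver n m) →
    mutableSubquiver (μ k Q) ≈ mutate FinP._≟_ k (mutableSubquiver Q)
  mutableSubquiver-μ k Q a b = by-cases (a FinP.≟ k) (b FinP.≟ k)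
    where
    by-cases : ∀ {a b} → Dec (a ≡ k) → Dec (b ≡ k) →
      mutableSubquiver (μ k Q) a b ≡ mutate FinP._≟_ k (mutableSubquiver Q) a b
    by-cases {b = b} (yes refl) _ =
      trans (MutationIce.mutate-out (inj₁ k) Q (inj₁ b)) (sym (MutationFin.mutate-out k (mutableSubquiver Q) b))
    by-cases {a = a} (no a≢k) (yes refl) =
      trans (MutationIce.mutate-in (inj₁ k) Q (inj₁-≢ a≢k))
            (sym (MutationFin.mutate-in k (mutableSubquiver Q) a≢k))
    by-cases (no a≢k) (no b≢k) =
      trans (MutationIce.mutate-away (inj₁ k) Q (inj₁-≢ a≢k) (inj₁-≢ b≢k))
            (sym (MutationFin.mutate-away k (mutableSubquiver Q) a≢k b≢k))

  mutationCyclic-μ : ∀ k {Q : IceQuiver n m} →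
    MutationCyclic (mutableSubquiver Q) → MutationCyclic (mutableSubquiver (μ k Q))
  mutationCyclic-μ k {Q} cyclic ks acyclic =
    cyclic (k ∷ ks) (MutationFin.acyclic-cong (MutationFin.mutateSeq-cong ks (mutableSubquiver-μ k Q)) acyclic)

  isQuiver-mutableSubquiver : ∀ {Q : IceQuiver n m} → IsQuiver Q → IsQuiver (mutableSubquiver Q)
  isQuiver-mutableSubquiver (loopless , no2cycle) =
    (λ a → loopless (inj₁ a)) , (λ a b → no2cycle (inj₁ a) (inj₁ b))

  outward-μ-self : ∀ {k} {Q : IceQuiver n m} → Outward Q k → Inward (μ k Q) k
  outward-μ-self {k} {Q} (noIn , nonzero) =
    (λ f → trans (μ-out-self k Q f) (noIn f)) , nonzero-cong (λ f → sym (μ-inn-self k Q f)) nonzero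

  inward-μ-self : ∀ {k} {Q : IceQuiver n m} → Inward Q k → Outward (μ k Q) k
  inward-μ-self {k} {Q} (noOut , nonzero) =
    (λ f → trans (μ-inn-self k Q f) (noOut f)) , nonzero-cong (λ f → sym (μ-out-self k Q f)) nonzero

  coherent-μ-self : ∀ k (Q : IceQuiver n m) → Coherent Q k → Coherent (μ k Q) k
  coherent-μ-self k Q (inj₁ outward) = inj₂ (outward-μ-self {k} {Q} outward)
  coherent-μ-self k Q (inj₂ inward)  = inj₁ (inward-μ-self {k} {Q} inward)

gain : ∀ o a i {q p} → p ≡ 0 → i + q ≤ o + a → q ≤ (o + a) ∸ (i + p) × (i + p) ∸ (o + a) ≡ 0
gain o a i {q} refl i+q≤ rewrite ℕP.+-identityʳ i =
    ℕP.m+n≤o⇒m≤o∸n q (subst (_≤ o + a) (ℕP.+-comm i q) i+q≤)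
  , ℕP.m≤n⇒m∸n≡0 (ℕP.m+n≤o⇒m≤o i i+q≤)

grow : ∀ {i q o a} → i ≡ 0 → 1 ≤ a → i + q ≤ o + a * q
grow {q = q} {o} {a} refl 1≤a = ℕP.≤-trans (ℕP.m≤n*m q a) (ℕP.m≤n+m (a * q) o)
  where instance _ = ℕ.>-nonZero 1≤a

overtake : ∀ {i q o a} → o ≡ 0 → 2 ≤ a → i ≤ q → i + q ≤ o + a * q
overtake {i} {q} {a = a} refl 2≤a i≤q = begin
  i + q      ≤⟨ ℕP.+-monoˡ-≤ q i≤q ⟩
  q + q      ≡⟨ cong (q +_) (sym (ℕP.+-identityʳ q)) ⟩
  2 * q      ≤⟨ ℕP.*-monoˡ-≤ q 2≤a ⟩
  a * q      ∎
  where open ℕP.≤-Reasoning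

module _ {n m : ℕ} {Q : IceQuiver n m} where

  gain-outward : ∀ {k x} → x ≢ k → (∀ f → inn Q k f ≡ 0) →
    (∀ f → inn Q x f + out Q k f ≤ out Q x f + mutableSubquiver Q x k * out Q k f) →
    ∀ f → out Q k f ≤ out (μ k Q) x f × inn (μ k Q) x f ≡ 0
  gain-outward {k} {x} x≢k k-noIn condition f rewrite μ-out Q f x≢k | μ-inn Q f x≢k | k-noIn f =
    gain (out Q x f) (mutableSubquiver Q x k * out Q k f) (inn Q x f) refl (condition f)

  gain-inward : ∀ {k x} → x ≢ k → (∀ f → out Q k f ≡ 0) →
    (∀ f → out Q x f + inn Q k f ≤ inn Q x f + mutableSubquiver Q k x * inn Q k f) →
    ∀ f → inn Q k f ≤ inn (μ k Q) x f × out (μ k Q) x f ≡ 0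
  gain-inward {k} {x} x≢k k-noOut condition f
    rewrite μ-out Q f x≢k | μ-inn Q f x≢k | k-noOut f
          | ℕP.*-zeroʳ (mutableSubquiver Q x k) | ℕP.*-comm (inn Q k f) (mutableSubquiver Q k x) =
    gain (inn Q x f) (mutableSubquiver Q k x * inn Q k f) (out Q x f) refl (condition f)

  outward-pair : ∀ {k x} → x ≢ k → Outward Q k →
    (∀ f → inn Q x f + out Q k f ≤ out Q x f + mutableSubquiver Q x k * out Q k f) →
    Inward≤Outward (μ k Q) k x
  outward-pair {k} {x} x≢k k-outward@(k-noIn , k-nonzero) condition =
    outward-μ-self {k = k} {Q = Q} k-outward , (proj₂ ∘ gained , nonzero-mono (proj₁ ∘ gained) k-nonzero) , k≤x
    where
    gained = gain-outward x≢k k-noIn condition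
    k≤x : ∀ f → inn (μ k Q) k f ≤ out (μ k Q) x f
    k≤x f = subst (_≤ out (μ k Q) x f) (sym (μ-inn-self k Q f)) (proj₁ (gained f))

  inward-pair : ∀ {k x} → x ≢ k → Inward Q k →
    (∀ f → out Q x f + inn Q k f ≤ inn Q x f + mutableSubquiver Q k x * inn Q k f) →
    Outward≤Inward (μ k Q) k x
  inward-pair {k} {x} x≢k k-inward@(k-noOut , k-nonzero) condition =
    inward-μ-self {k = k} {Q = Q} k-inward , (proj₂ ∘ gained , nonzero-mono (proj₁ ∘ gained) k-nonzero) , k≤x
    where
    gained = gain-inward x≢k k-noOut condition
    k≤x : ∀ f → out (μ k Q) k f ≤ inn (μ k Q) x f
    k≤x f = subst (_≤ inn (μ k Q) x f) (sym (μ-out-self k Q f)) (proj₁ (gained f))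

  unchanged : ∀ {k x} → x ≢ k →
    (mutableSubquiver Q x k ≡ 0 ⊎ (∀ f → out Q k f ≡ 0)) →
    (mutableSubquiver Q k x ≡ 0 ⊎ (∀ f → inn Q k f ≡ 0)) →
    Coherent Q x → Coherent (μ k Q) x
  unchanged {k} {x} x≢k no-x→k→f no-f→k→x = preserved
    where
    path-out : ∀ f → mutableSubquiver Q x k * out Q k f ≡ 0
    path-out f = [ (λ x↛k → cong (_* out Q k f) x↛k)
                 , (λ k-noOut → trans (cong (mutableSubquiver Q x k *_) (k-noOut f))
                                      (ℕP.*-zeroʳ (mutableSubquiver Q x k))) ]′ no-x→k→f
    path-in : ∀ f → inn Q k f * mutableSubquiver Q k x ≡ 0
    path-in f = [ (λ k↛x → trans (cong (inn Q k f *_) k↛x) (ℕP.*-zeroʳ (inn Q k f)))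
                , (λ k-noIn → cong (_* mutableSubquiver Q k x) (k-noIn f)) ]′ no-f→k→x
    drop : ∀ a {b} → b ≡ 0 → a + b ≡ a
    drop a refl = ℕP.+-identityʳ a
    out′ : ∀ f → out (μ k Q) x f ≡ out Q x f ∸ inn Q x f
    out′ f = trans (μ-out Q f x≢k) (cong₂ _∸_ (drop (out Q x f) (path-out f)) (drop (inn Q x f) (path-in f)))
    inn′ : ∀ f → inn (μ k Q) x f ≡ inn Q x f ∸ out Q x f
    inn′ f = trans (μ-inn Q f x≢k) (cong₂ _∸_ (drop (inn Q x f) (path-in f)) (drop (out Q x f) (path-out f)))
    preserved : Coherent Q x → Coherent (μ k Q) x
    preserved (inj₁ (noIn , nonzero)) =
      inj₁ ( (λ f → trans (inn′ f) (trans (cong (_∸ out Q x f) (noIn f)) (ℕP.0∸n≡0 (out Q x f))))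
           , nonzero-cong (λ f → sym (trans (out′ f) (cong (out Q x f ∸_) (noIn f)))) nonzero)
    preserved (inj₂ (noOut , nonzero)) =
      inj₂ ( (λ f → trans (out′ f) (trans (cong (_∸ inn Q x f) (noOut f)) (ℕP.0∸n≡0 (inn Q x f))))
           , nonzero-cong (λ f → sym (trans (inn′ f) (cong (inn Q x f ∸_) (noOut f)))) nonzero)

-- The invariant along mutation sequences

Pattern : {m : ℕ} → IceQuiver 3 m → Fin 3 → Fin 3 → Fin 3 → Set
Pattern Q v J I = (Outward≤Inward Q v I × Coherent Q J) ⊎ (Inward≤Outward Q v J × Coherent Q I)

module _ {m : ℕ} {Q : IceQuiver 3 m} {v J I : Fin 3} (cycle : Cycle (mutableSubquiver Q) v J I) where
  open Cycle cycle

  pattern-coherent : Pattern Q v J I → ∀ x → Coherent Q x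
  pattern-coherent (inj₁ ((v-out , I-in , _) , J-coherent)) = around distinct (inj₁ v-out) J-coherent (inj₂ I-in)
  pattern-coherent (inj₂ ((v-in , J-out , _) , I-coherent)) = around distinct (inj₂ v-in) (inj₁ J-out) I-coherent

  pattern-μ-successor : Pattern Q v J I → Pattern (μ J Q) J v I
  pattern-μ-successor (inj₁ ((v-out , I-in , _) , inj₁ J-out)) =
    inj₂ ( outward-pair v≢J J-out (λ f → grow (proj₁ v-out f) (heavy⇒positive v⇉J))
         , unchanged (≢-sym J≢I) (inj₁ I↛J) (inj₂ (proj₁ J-out)) (inj₂ I-in))
  pattern-μ-successor (inj₁ ((v-out , I-in , _) , inj₂ J-in)) =
    inj₁ ( inward-pair (≢-sym J≢I) J-in (λ f → grow (proj₁ I-in f) (heavy⇒positive J⇉I))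
         , unchanged v≢J (inj₂ (proj₁ J-in)) (inj₁ J↛v) (inj₁ v-out))
  pattern-μ-successor (inj₂ ((v-in , J-out , v≤J) , I-coherent)) =
    inj₂ ( outward-pair v≢J J-out (λ f → overtake (proj₁ v-in f) v⇉J (v≤J f))
         , unchanged (≢-sym J≢I) (inj₁ I↛J) (inj₂ (proj₁ J-out)) I-coherent)

  pattern-μ-predecessor : Pattern Q v J I → Pattern (μ I Q) I J v
  pattern-μ-predecessor (inj₁ ((v-out , I-in , v≤I) , J-coherent)) =
    inj₁ ( inward-pair (≢-sym I≢v) I-in (λ f → overtake (proj₁ v-out f) I⇉v (v≤I f))
         , unchanged J≢I (inj₂ (proj₁ I-in)) (inj₁ I↛J) J-coherent)
  pattern-μ-predecessor (inj₂ ((v-in , J-out , _) , inj₁ I-out)) =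
    inj₂ ( outward-pair J≢I I-out (λ f → grow (proj₁ J-out f) (heavy⇒positive J⇉I))
         , unchanged (≢-sym I≢v) (inj₁ v↛I) (inj₂ (proj₁ I-out)) (inj₂ v-in))
  pattern-μ-predecessor (inj₂ ((v-in , J-out , _) , inj₂ I-in)) =
    inj₁ ( inward-pair (≢-sym I≢v) I-in (λ f → grow (proj₁ v-in f) (heavy⇒positive I⇉v))
         , unchanged J≢I (inj₂ (proj₁ I-in)) (inj₁ I↛J) (inj₁ J-out))

record Rooted {m : ℕ} (Q : IceQuiver 3 m) (v : Fin 3) : Set where
  constructor rooted
  field
    {J I}  : Fin 3
    cycle  : Cycle (mutableSubquiver Q) v J I
    signs  : Pattern Q v J I

rooted-coherent : ∀ {m} {Q : IceQuiver 3 m} {v} → Rooted Q v → ∀ x → Coherent Q x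
rooted-coherent {Q = Q} (rooted cycle signs) = pattern-coherent {Q = Q} cycle signs

module _ {m : ℕ} {Q : IceQuiver 3 m} (isQ : IsQuiver Q) (cyclic : MutationCyclic (mutableSubquiver Q)) where

  triangle-μ : ∀ k → ∃[ d ] CyclicTriangle (mutableSubquiver (μ k Q)) d
  triangle-μ k =
    mutationCyclic⇒cyclicTriangle (isQuiver-mutableSubquiver (MutationIce.mutate-isQuiver (inj₁ k) isQ))
                                  (mutationCyclic-μ k cyclic)

  rooted-μ : ∀ {v} → Rooted Q v → ∀ {k} → k ≢ v → Rooted (μ k Q) k
  rooted-μ {v} (rooted {J} {I} cycle signs) {k} k≢v with distinct-cover (Cycle.distinct cycle) k
  ... | inj₁ k≡v         = contradiction k≡v k≢v
  ... | inj₂ (inj₁ refl) =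
    rooted (cycle-through (proj₂ (triangle-μ k)) (≢-sym v≢J , ≢-sym I≢v , ≢-sym J≢I)
              (subst (0 <_) (sym (μ-arrow-out k Q v)) (heavy⇒positive v⇉J)))
           (pattern-μ-successor cycle signs)
    where open Cycle cycle
  ... | inj₂ (inj₂ refl) =
    rooted (cycle-through (proj₂ (triangle-μ k)) (≢-sym J≢I , ≢-sym v≢J , ≢-sym I≢v)
              (subst (0 <_) (sym (μ-arrow-out k Q J)) (heavy⇒positive J⇉I)))
           (pattern-μ-predecessor cycle signs)
    where open Cycle cycle

module _ {m : ℕ} {Q₀ : IceQuiver 3 m} (isQ₀ : IsQuiver Q₀) (cyclic₀ : MutationCyclic (mutableSubquiver Q₀))
         (roots : ∀ x → Rooted (μ x Q₀) x) where

  -- mutation histories from Q₀, kept as a stack: mutating again at the top vertex pops it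
  data Reachable : IceQuiver 3 m → Set where
    origin  : Reachable Q₀
    mutated : ∀ {P} v → Reachable P → Rooted (μ v P) v → Reachable (μ v P)

  reachable-isQuiver : ∀ {P} → Reachable P → IsQuiver P
  reachable-isQuiver origin         = isQ₀
  reachable-isQuiver (mutated v r _) = MutationIce.mutate-isQuiver (inj₁ v) (reachable-isQuiver r)

  reachable-cyclic : ∀ {P} → Reachable P → MutationCyclic (mutableSubquiver P)
  reachable-cyclic origin         = cyclic₀
  reachable-cyclic (mutated v r _) = mutationCyclic-μ v (reachable-cyclic r)

  reachable-coherent : ∀ {P} → Reachable P → ∀ x → Coherent P x
  reachable-coherent origin x =
    coherent-cong (MutationIce.mutate-involutive (inj₁ x) isQ₀)
                  (coherent-μ-self x (μ x Q₀) (rooted-coherent (roots x) x))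
  reachable-coherent (mutated v _ root) = rooted-coherent root

  coherent-along : ∀ ks {P Q} → Reachable P → Q ≈ P → ∀ x → Coherent (μSeq ks Q) x
  coherent-along []       r Q≈P x = coherent-cong (≈-sym Q≈P) (reachable-coherent r x)
  coherent-along (k ∷ ks) origin Q≈P =
    coherent-along ks (mutated k origin (roots k)) (MutationIce.mutate-cong (inj₁ k) Q≈P)
  coherent-along (k ∷ ks) (mutated v r root) Q≈P with k FinP.≟ v
  ... | yes refl = coherent-along ks r
                     (≈-trans (MutationIce.mutate-cong (inj₁ k) Q≈P)
                              (MutationIce.mutate-involutive (inj₁ k) (reachable-isQuiver r)))
  ... | no k≢v   = coherent-along ks (mutated k (mutated v r root) (rooted-μ isQ cyclic root k≢v))
                     (MutationIce.mutate-cong (inj₁ k) Q≈P)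
    where isQ    = reachable-isQuiver (mutated v r root)
          cyclic = reachable-cyclic (mutated v r root)

-- c-vectors

module _ {n m : ℕ} (Q : IceQuiver n m) (x : Fin n) where

  c-outward : ∀ {f} → inn Q x f ≡ 0 → c Q x f ≡ ℤ.+ out Q x f
  c-outward {f} noIn rewrite noIn = ℤP.+-identityʳ (ℤ.+ out Q x f)

  c-inward : ∀ {f} → out Q x f ≡ 0 → c Q x f ≡ ℤ.- (ℤ.+ inn Q x f)
  c-inward {f} noOut rewrite noOut = ℤP.+-identityˡ (ℤ.- (ℤ.+ inn Q x f))

  outward⇒green : Outward Q x → Green Q x
  outward⇒green (noIn , nonzero) =
      (λ c≡0 → nonzero λ f → ℤP.+-injective (trans (sym (c-outward (noIn f))) (c≡0 f)))
    , (λ f → subst (0ℤ ℤ.≤_) (sym (c-outward (noIn f))) (+≤+ z≤n))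

  inward⇒red : Inward Q x → Red Q x
  inward⇒red (noOut , nonzero) =
      (λ c≡0 → nonzero λ f → ℤP.+-injective (ℤP.neg-injective (trans (sym (c-inward (noOut f))) (c≡0 f))))
    , (λ f → subst (ℤ._≤ 0ℤ) (sym (c-inward (noOut f))) ℤP.neg-≤-pos)

  coherent⇒redOrGreen : Coherent Q x → Red Q x ⊎ Green Q x
  coherent⇒redOrGreen (inj₁ outward) = inj₂ (outward⇒green outward)
  coherent⇒redOrGreen (inj₂ inward)  = inj₁ (inward⇒red inward)

strictlySignCoherent : ∀ {m} {Q : IceQuiver 3 m} → IsQuiver Q → MutationCyclic (mutableSubquiver Q) →
  (∀ x {J I} → Cycle (mutableSubquiver (μ x Q)) x J I → Pattern (μ x Q) x J I) →
  StrictlySignCoherent Q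
strictlySignCoherent {Q = Q} isQ cyclic rootPattern ks x =
  coherent⇒redOrGreen (μSeq ks Q) x (coherent-along isQ cyclic roots ks origin (λ _ _ → refl) x)
  where
  roots : ∀ x → Rooted (μ x Q) x
  roots x = let cycle = cycle-at (proj₂ (triangle-μ isQ cyclic x)) x in rooted cycle (rootPattern x cycle)

module _ {m : ℕ} {Q : IceQuiver 3 m} {x J I : Fin 3} (cycle : Cycle (mutableSubquiver (μ x Q)) x J I) where
  open Cycle cycle

  allOutward-pattern : (∀ y → Outward Q y) → Pattern (μ x Q) x J I
  allOutward-pattern outward =
    inj₂ ( outward-pair (≢-sym v≢J) (outward x)
             (λ f → grow (proj₁ (outward J) f) (heavy⇒positive (subst (2 ≤_) (μ-arrow-out x Q J) v⇉J)))
         , unchanged I≢v (inj₁ (trans (sym (μ-arrow-out x Q I)) v↛I)) (inj₂ (proj₁ (outward x)))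
             (inj₁ (outward I)))

  allInward-pattern : (∀ y → Inward Q y) → Pattern (μ x Q) x J I
  allInward-pattern inward =
    inj₁ ( inward-pair I≢v (inward x)
             (λ f → grow (proj₁ (inward I) f) (heavy⇒positive (subst (2 ≤_) (μ-arrow-in x Q I≢v) I⇉v)))
         , unchanged (≢-sym v≢J) (inj₂ (proj₁ (inward x)))
             (inj₁ (trans (sym (μ-arrow-in x Q (≢-sym v≢J))) J↛v))
             (inj₂ (inward J)))

+*-nonneg : ∀ n {u} → 0ℤ ℤ.≤ u → 0ℤ ℤ.≤ ℤ.+ n ℤ.* u
+*-nonneg n {u} 0≤u =
  subst (ℤ._≤ ℤ.+ n ℤ.* u) (ℤP.*-zeroʳ (ℤ.+ n)) (ℤP.*-monoˡ-≤-nonNeg (ℤ.+ n) 0≤u)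

+*-nonpos : ∀ n {u} → u ℤ.≤ 0ℤ → ℤ.+ n ℤ.* u ℤ.≤ 0ℤ
+*-nonpos n {u} u≤0 =
  subst (ℤ.+ n ℤ.* u ℤ.≤_) (ℤP.*-zeroʳ (ℤ.+ n)) (ℤP.*-monoˡ-≤-nonNeg (ℤ.+ n) u≤0)

-*-nonneg : ∀ n {u} → 0ℤ ℤ.≤ u → ℤ.- (ℤ.+ n) ℤ.* u ℤ.≤ 0ℤ
-*-nonneg n {u} 0≤u = subst (ℤ._≤ 0ℤ) (ℤP.neg-distribˡ-* (ℤ.+ n) u) (ℤP.neg-mono-≤ (+*-nonneg n 0≤u))

-*-nonpos : ∀ n {u} → u ℤ.≤ 0ℤ → 0ℤ ℤ.≤ ℤ.- (ℤ.+ n) ℤ.* u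
-*-nonpos n {u} u≤0 = subst (0ℤ ℤ.≤_) (ℤP.neg-distribˡ-* (ℤ.+ n) u) (ℤP.neg-mono-≤ (+*-nonpos n u≤0))

sgnV-green : ∀ {m} {u : Vecℤ m} → IsGreenV u → sgnV u ≡ 1ℤ
sgnV-green {u = u} green with green? u
... | yes _     = refl
... | no ¬green = contradiction green ¬green

sgnV-red : ∀ {m} {u : Vecℤ m} → IsRedV u → sgnV u ≡ -1ℤ
sgnV-red {u = u} red@(nonzero , nonpos) with green? u | red? u
... | yes (_ , nonneg) | _      = contradiction (λ f → ℤP.≤-antisym (nonpos f) (nonneg f)) nonzero
... | no _             | yes _  = refl
... | no _             | no ¬red = contradiction red ¬red

sgnV-green≢red : ∀ {m} {u w : Vecℤ m} → IsGreenV u → IsRedV w → sgnV u ≢ sgnV w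
sgnV-green≢red green red eq with trans (sym (sgnV-green green)) (trans eq (sgnV-red red))
... | ()

sgnV-green≢-green : ∀ {m} {u w : Vecℤ m} → IsGreenV u → IsGreenV w → sgnV u ≢ ℤ.- sgnV w
sgnV-green≢-green green green′ eq with trans (sym (sgnV-green green)) (trans eq (cong ℤ.-_ (sgnV-green green′)))
... | ()

sgnV-red≢-red : ∀ {m} {u w : Vecℤ m} → IsRedV u → IsRedV w → sgnV u ≢ ℤ.- sgnV w
sgnV-red≢-red red red′ eq with trans (sym (sgnV-red red)) (trans eq (cong ℤ.-_ (sgnV-red red′)))
... | ()

module _ {n m : ℕ} (Q : IceQuiver n m) where

  B-forward : ∀ a b → mutableSubquiver Q b a ≡ 0 → B Q a b ≡ ℤ.+ mutableSubquiver Q a b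
  B-forward a b b↛a rewrite b↛a = ℤP.+-identityʳ (ℤ.+ mutableSubquiver Q a b)

  B-backward : ∀ a b → mutableSubquiver Q a b ≡ 0 → B Q a b ≡ ℤ.- (ℤ.+ mutableSubquiver Q b a)
  B-backward a b a↛b rewrite a↛b = ℤP.+-identityˡ (ℤ.- (ℤ.+ mutableSubquiver Q b a))

  forward·green : ∀ a b → mutableSubquiver Q b a ≡ 0 → Green Q b → 0v ≤v (B Q a b ·v c Q b)
  forward·green a b b↛a green f =
    subst (λ β → 0ℤ ℤ.≤ β ℤ.* c Q b f) (sym (B-forward a b b↛a))
          (+*-nonneg (mutableSubquiver Q a b) (proj₂ green f))

  forward·red : ∀ a b → mutableSubquiver Q b a ≡ 0 → Red Q b → (B Q a b ·v c Q b) ≤v 0v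
  forward·red a b b↛a red f =
    subst (λ β → β ℤ.* c Q b f ℤ.≤ 0ℤ) (sym (B-forward a b b↛a))
          (+*-nonpos (mutableSubquiver Q a b) (proj₂ red f))

  backward·green : ∀ a b → mutableSubquiver Q a b ≡ 0 → Green Q b → (B Q a b ·v c Q b) ≤v 0v
  backward·green a b a↛b green f =
    subst (λ β → β ℤ.* c Q b f ℤ.≤ 0ℤ) (sym (B-backward a b a↛b))
          (-*-nonneg (mutableSubquiver Q b a) (proj₂ green f))

  backward·red : ∀ a b → mutableSubquiver Q a b ≡ 0 → Red Q b → 0v ≤v (B Q a b ·v c Q b)
  backward·red a b a↛b red f =
    subst (λ β → 0ℤ ℤ.≤ β ℤ.* c Q b f) (sym (B-backward a b a↛b))
          (-*-nonpos (mutableSubquiver Q b a) (proj₂ red f))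

module _ {n m : ℕ} {Q : IceQuiver n m} (isQ : IsQuiver Q) (x : Fin n) where

  green⇒outward : Green Q x → Outward Q x
  green⇒outward (nonzero , nonneg) =
    noIn , λ out≡0 → nonzero λ f → trans (c-outward Q x (noIn f)) (cong ℤ.+_ (out≡0 f))
    where
    neg-nonneg : ∀ k → 0ℤ ℤ.≤ ℤ.- (ℤ.+ k) → k ≡ 0
    neg-nonneg zero    _  = refl
    neg-nonneg (suc k) ()
    noIn : ∀ f → inn Q x f ≡ 0
    noIn f with proj₂ isQ (inj₁ x) (inj₂ f)
    ... | inj₂ inn≡0 = inn≡0
    ... | inj₁ out≡0 = neg-nonneg (inn Q x f) (subst (0ℤ ℤ.≤_) (c-inward Q x out≡0) (nonneg f))

  red⇒inward : Red Q x → Inward Q x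
  red⇒inward (nonzero , nonpos) =
    noOut , λ inn≡0 → nonzero λ f → trans (c-inward Q x (noOut f)) (cong (λ k → ℤ.- (ℤ.+ k)) (inn≡0 f))
    where
    pos-nonpos : ∀ k → ℤ.+ k ℤ.≤ 0ℤ → k ≡ 0
    pos-nonpos zero    _           = refl
    pos-nonpos (suc k) (+≤+ ())
    noOut : ∀ f → out Q x f ≡ 0
    noOut f with proj₂ isQ (inj₁ x) (inj₂ f)
    ... | inj₁ out≡0 = out≡0
    ... | inj₂ inn≡0 = pos-nonpos (out Q x f) (subst (ℤ._≤ 0ℤ) (c-outward Q x inn≡0) (nonpos f))

  signed-green : Green Q x → ∀ f → sgnV (c Q x) ℤ.* c Q x f ≡ ℤ.+ out Q x f
  signed-green green f rewrite sgnV-green green | c-outward Q x (proj₁ (green⇒outward green) f) =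
    ℤP.*-identityˡ (ℤ.+ out Q x f)

  signed-red : Red Q x → ∀ f → sgnV (c Q x) ℤ.* c Q x f ≡ ℤ.+ inn Q x f
  signed-red red f rewrite sgnV-red red | c-inward Q x (proj₁ (red⇒inward red) f) =
    trans (ℤP.-1*i≡-i (ℤ.- (ℤ.+ inn Q x f))) (ℤP.neg-involutive (ℤ.+ inn Q x f))

module _ {n m : ℕ} {Q : IceQuiver n m} (isQ : IsQuiver Q) (x y : Fin n) where

  signed≤⇒out≤inn : Green Q x → Red Q y → (sgnV (c Q x) ·v c Q x) ≤v (sgnV (c Q y) ·v c Q y) →
    ∀ f → out Q x f ≤ inn Q y f
  signed≤⇒out≤inn green red signed≤ f =
    ℤP.drop‿+≤+ (subst₂ ℤ._≤_ (signed-green isQ x green f) (signed-red isQ y red f) (signed≤ f))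

  signed≤⇒inn≤out : Red Q x → Green Q y → (sgnV (c Q x) ·v c Q x) ≤v (sgnV (c Q y) ·v c Q y) →
    ∀ f → inn Q x f ≤ out Q y f
  signed≤⇒inn≤out red green signed≤ f =
    ℤP.drop‿+≤+ (subst₂ ℤ._≤_ (signed-red isQ x red f) (signed-green isQ y green f) (signed≤ f))

conditions⇒pattern : ∀ {m} {Q : IceQuiver 3 m} {v J I} → IsQuiver (μ v Q) →
  Cycle (mutableSubquiver (μ v Q)) v J I → ConditionsAt Q v → Pattern (μ v Q) v J I
conditions⇒pattern {Q = Q} {v} {J} {I} isQ cycle (redOrGreen , sameSignOrDominated , oppositeSign , _) =
  [ red-root , green-root ]′ (redOrGreen v)
  where
  open Cycle cycle
  P = μ v Q

  coherent : ∀ y → Coherent P y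
  coherent y = [ (λ red → inj₂ (red⇒inward isQ y red)) , (λ green → inj₁ (green⇒outward isQ y green)) ]′
                 (redOrGreen y)

  green-root : Green P v → Pattern P v J I
  green-root v-green = inj₁ ((green⇒outward isQ v v-green , red⇒inward isQ I I-red , out≤inn) , coherent J)
    where
    I-red : Red P I
    I-red = [ id , (λ I-green → contradiction (oppositeSign I I≢v (backward·green P v I v↛I I-green))
                                              (sgnV-green≢-green I-green v-green)) ]′ (redOrGreen I)
    out≤inn : ∀ f → out P v f ≤ inn P I f
    out≤inn = [ (λ same → contradiction (sym same) (sgnV-green≢red v-green I-red))
              , signed≤⇒out≤inn isQ v I v-green I-red ]′
                (sameSignOrDominated I I≢v (backward·red P v I v↛I I-red))

  red-root : Red P v → Pattern P v J I
  red-root v-red = inj₂ ((red⇒inward isQ v v-red , green⇒outward isQ J J-green , inn≤out) , coherent I)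
    where
    J-green : Green P J
    J-green = [ (λ J-red → contradiction (oppositeSign J (≢-sym v≢J) (forward·red P v J J↛v J-red))
                                         (sgnV-red≢-red J-red v-red)) , id ]′ (redOrGreen J)
    inn≤out : ∀ f → inn P v f ≤ out P J f
    inn≤out = [ (λ same → contradiction same (sgnV-green≢red J-green v-red))
              , signed≤⇒inn≤out isQ v J v-red J-green ]′
                (sameSignOrDominated J (≢-sym v≢J) (forward·green P v J J↛v J-green))

-- Framings

module _ {n : ℕ} {Q : Quiver (Fin n)} (isQ : IsQuiver Q) where

  framing-isQuiver : IsQuiver (framing Q)
  framing-isQuiver = loopless , no2cycle
    where
    loopless : ∀ a → framing Q a a ≡ 0
    loopless (inj₁ i) = proj₁ isQ i
    loopless (inj₂ _) = refl
    no2cycle : ∀ a b → framing Q a b ≡ 0 ⊎ framing Q b a ≡ 0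
    no2cycle (inj₁ i) (inj₁ j) = proj₂ isQ i j
    no2cycle (inj₁ _) (inj₂ _) = inj₂ refl
    no2cycle (inj₂ _) _        = inj₁ refl

  coframing-isQuiver : IsQuiver (coframing Q)
  coframing-isQuiver = loopless , no2cycle
    where
    loopless : ∀ a → coframing Q a a ≡ 0
    loopless (inj₁ i) = proj₁ isQ i
    loopless (inj₂ _) = refl
    no2cycle : ∀ a b → coframing Q a b ≡ 0 ⊎ coframing Q b a ≡ 0
    no2cycle (inj₁ i) (inj₁ j) = proj₂ isQ i j
    no2cycle (inj₁ _) (inj₂ _) = inj₁ refl
    no2cycle (inj₂ _) (inj₁ _) = inj₂ refl
    no2cycle (inj₂ _) (inj₂ _) = inj₁ refl

module _ {n : ℕ} (Q : Quiver (Fin n)) where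

  framing-outward : ∀ y → Outward (framing Q) y
  framing-outward y = (λ _ → refl) , λ out≡0 → contradiction (trans (sym framed) (out≡0 y)) λ ()
    where
    framed : out (framing Q) y y ≡ 1
    framed with y FinP.≟ y
    ... | yes _   = refl
    ... | no y≢y = contradiction refl y≢y

  coframing-inward : ∀ y → Inward (coframing Q) y
  coframing-inward y = (λ _ → refl) , λ inn≡0 → contradiction (trans (sym coframed) (inn≡0 y)) λ ()
    where
    coframed : inn (coframing Q) y y ≡ 1
    coframed with y FinP.≟ y
    ... | yes _   = refl
    ... | no y≢y = contradiction refl y≢y

corollary5p7 :
    (∀ (m : ℕ) (Q : IceQuiver 3 m) →
       IsQuiver Q →
       MutationCyclic (mutableSubquiver Q) →
       (∀ (v : Fin 3) → ConditionsAt Q v) →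
       StrictlySignCoherent Q)
    × (∀ (Q : Quiver (Fin 3)) →
       IsQuiver Q →
       MutationCyclic Q →
       StrictlySignCoherent (framing Q) × StrictlySignCoherent (coframing Q))
corollary5p7 =
    (λ m Q isQ cyclic conditions → strictlySignCoherent isQ cyclic λ v cycle →
       conditions⇒pattern (MutationIce.mutate-isQuiver (inj₁ v) isQ) cycle (conditions v))
  , λ Q isQ cyclic →
        strictlySignCoherent (framing-isQuiver isQ) cyclic
          (λ _ cycle → allOutward-pattern cycle (framing-outward Q))
      , strictlySignCoherent (coframing-isQuiver isQ) cyclic
          (λ _ cycle → allInward-pattern cycle (coframing-inward Q))
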